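{- Let $\mathcal{M}=(E,r,m)$ be a ranked set with multiplicity. Then, as rational functions in $s,u_e,v_e$, $$\prod_{e\in E}(1-u_e)\;\mathbf{Z}_{\mathcal{M}}\Bigl(s,\bigl(\tfrac{v_e(1-2u_e)}{1-u_e}\bigr)_{e\in E}\Bigr)=\sum_{A\subseteq E}s^{ -r(A)}\prod_{e\in A}(-v_e)\;\mathbf{Z}_{\mathcal{M}/A}\bigl(s,(v_e)_{e\in E\setminus A}\bigr)\prod_{e\in A}u_e\prod_{e\in E\setminus A}(1-u_e).$$ Consequently, with $R=\mathbb{R}$ and $p_e\in[0,1]$, $$\mathbb{E}\Bigl[s^{ -r(E_{\underline p})}\prod_{e\in E_{\underline p}}(-v_e)\;\mathbf{Z}_{\mathcal{M}/E_{\underline p}}\bigl(s,(v_e)_{e\in E\setminus E_{\underline p}}\bigr)\Bigr]=\prod_{e\in E}(1-p_e)\;\mathbf{Z}_{\mathcal{M}}\Bigl(s,\bigl(\tfrac{v_e(1-2p_e)}{1-p_e}\bigr)_{e\in E}\Bigr).$$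
   Context: A ranked set with multiplicity (rsm) is $\mathcal{M}=(E,r,m)$ with $E$ finite, $r:2^E\to\mathbb{Z}$ arbitrary ($r(\emptyset)$ may be nonzero), $m:2^E\to R$ arbitrary, $R$ a commutative ring with $1$. $\mathbf{Z}_{\mathcal{M}}(q,(v_e))=\sum_{A\subseteq E}m(A)q^{ -r(A)}\prod_{e\in A}v_e$. Contraction $\mathcal{M}/A=(E\setminus A,r',m')$ with $r'(B)=r(B\cup A)-r(A)$, $m'(B)=m(B\cup A)$. $E_{\underline p}$ is the random subset containing each $e$ independently with probability $p_e$. The right-hand side of the expectation formula equals the polynomial $\sum_{A\subseteq E}m(A)s^{ -r(A)}\prod_{e\in A}v_e(1-2p_e)\prod_{e\in E\setminus A}(1-p_e)$. -}

module Defs where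

open import Level using (Level)
open import Algebra.Bundles using (CommutativeRing)
open import Data.Nat using (ℕ; zero; suc)
open import Data.Integer using (ℤ; +_; -[1+_]) renaming (_-_ to _-ℤ_; -_ to -ℤ_)
open import Data.Bool using (Bool; true; false; if_then_else_)
open import Data.Vec using (Vec; []; _∷_; lookup)
open import Data.Fin using (Fin)
open import Data.Fin.Subset using (Subset; _∪_; _─_; ∁)
open import Data.List using (List; []; _∷_; _++_; map; foldr)

subsetsOf : ∀ {n} → Subset n → List (Subset n)
subsetsOf [] = [] ∷ []
subsetsOf (false ∷ G) = map (false ∷_) (subsetsOf G)
subsetsOf (true ∷ G) = map (false ∷_) (subsetsOf G) ++ map (true ∷_) (subsetsOf G)

-- A ranked set with multiplicity, with ground set G ⊆ Fin n (the finite set E).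
-- r and m are given on all subsets of Fin n; only their values on subsets of G matter.
record RSM {c : Level} (n : ℕ) (C : Set c) : Set c where
  field
    ground : Subset n
    rank   : Subset n → ℤ
    mult   : Subset n → C

open RSM public

contract : ∀ {c n} {C : Set c} → RSM n C → Subset n → RSM n C
contract M A = record
  { ground = ground M ─ A
  ; rank   = λ B → rank M (B ∪ A) -ℤ rank M A
  ; mult   = λ B → mult M (B ∪ A) }

module _ {c ℓ} (R : CommutativeRing c ℓ) where
  open CommutativeRing R

  sumL : ∀ {n} → List (Subset n) → (Subset n → Carrier) → Carrier
  sumL xs f = foldr (λ x acc → f x + acc) 0# xs

  prodFin : ∀ n → (Fin n → Carrier) → Carrier
  prodFin zero f = 1#
  prodFin (suc n) f = f Fin.zero * prodFin n (λ i → f (Fin.suc i))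

  prodIn : ∀ {n} → Subset n → (Fin n → Carrier) → Carrier
  prodIn {n} A f = prodFin n (λ e → if lookup A e then f e else 1#)

  pow : Carrier → ℕ → Carrier
  pow x zero = 1#
  pow x (suc k) = x * pow x k

  -- integer powers of a unit s, given its inverse t (s * t ≈ 1)
  zpow : Carrier → Carrier → ℤ → Carrier
  zpow s t (+ k) = pow s k
  zpow s t -[1+ k ] = pow t (suc k)

  Z : ∀ {n} → RSM n Carrier → Carrier → Carrier → (Fin n → Carrier) → Carrier
  Z M q qinv v = sumL (subsetsOf (ground M))
                   (λ A → mult M A * zpow q qinv (-ℤ rank M A) * prodIn A v)

  -- Expectation of X(E_p) for the random subset E_p ⊆ E = ground M,
  -- each e included independently with probability p e:
  -- E[X(E_p)] = Σ_{A ⊆ E} (∏_{e∈A} p_e ∏_{e∈E∖A} (1 - p_e)) X(A).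
  expect : ∀ {n} → Subset n → (Fin n → Carrier) → (Subset n → Carrier) → Carrier
  expect E p X = sumL (subsetsOf E)
                   (λ A → prodIn A p * prodIn (E ─ A) (λ e → 1# - p e) * X A)

module Submission where

-- The heart of the proof is the second identity (the expectation formula),
-- valid for arbitrary weights p in any commutative ring.  Expanding the
-- contracted partition function Z_{M/A} turns the left-hand side into a
-- double sum over A ⊆ E and B ⊆ E ∖ A.  Substituting C = A ∪ B reindexes it
-- as a sum over C ⊆ E of inner sums over A ⊆ C.  In each inner sum the
-- powers of s combine to s^{-r(C)} (the exponents telescope), the factor
-- ∏_{E∖A}(1-p) splits as ∏_{C∖A}(1-p) · ∏_{E∖C}(1-p), and what remains is
-- the binomial expansion Σ_{A⊆C} ∏_A(-p v) ∏_{C∖A}((1-p) v) = ∏_C v(1-2p).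
-- The first identity is then a corollary: multiplying out ∏_E(1-u) against
-- the weights w = (1-u)⁻¹ leaves exactly the right-hand side of the
-- expectation formula with p = u, and the expectation unfolds into the sum.

open import Data.Product using (_×_; _,_)
open import Defs
open import Algebra.Bundles using (CommutativeRing)
open import Data.Nat using (ℕ; zero; suc)
open import Data.Integer using (ℤ; -[1+_]; pred)
  renaming (+_ to pos; suc to sucℤ; _-_ to _-ℤ_; -_ to -ℤ_; _+_ to _+ℤ_)
import Data.Integer.Properties as ℤ
open import Data.Integer.Tactic.RingSolver using (solve-∀)
open import Data.Bool using (Bool; true; false)
open import Data.Vec using ([]; _∷_)
open import Data.Fin using (Fin)
open import Data.Fin.Subset using (Subset; _∪_; _─_)
open import Data.List using (List; []; _∷_; _++_; map)
import Relation.Binary.PropositionalEquality as P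
import Algebra.Solver.CommutativeMonoid as CommutativeMonoidSolver
import Algebra.Properties.Ring as RingProperties
import Algebra.Properties.CommutativeSemigroup as CommutativeSemigroupProperties
import Algebra.Properties.AbelianGroup as AbelianGroupProperties

neg-telescope : ∀ a c → -ℤ a +ℤ -ℤ (c -ℤ a) P.≡ -ℤ c
neg-telescope = solve-∀

-- A ⊑ G: A is a subset of G, as an inductive relation following the bit
-- vectors, so that proofs about A ⊆ G can proceed by recursion on it.
infix 4 _⊑_
data _⊑_ : ∀ {n} → Subset n → Subset n → Set where
  []⊑[]   : [] ⊑ []
  outside : ∀ {n} {A G : Subset n} → A ⊑ G → false ∷ A ⊑ false ∷ G
  skipped : ∀ {n} {A G : Subset n} → A ⊑ G → false ∷ A ⊑ true ∷ G
  taken   : ∀ {n} {A G : Subset n} → A ⊑ G → true ∷ A ⊑ true ∷ G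

module _ {c ℓ} (R : CommutativeRing c ℓ) where
  open CommutativeRing R
  open import Relation.Binary.Reasoning.Setoid setoid
  open CommutativeMonoidSolver *-commutativeMonoid
    using (_⊜_) renaming (solve to *-solve; _⊕_ to _⊛_)
  open RingProperties ring using (-‿distribˡ-*; -‿distribʳ-*)
  open CommutativeSemigroupProperties +-commutativeSemigroup
    using () renaming (interchange to +-interchange)

  Σ : ∀ {n} → List (Subset n) → (Subset n → Carrier) → Carrier
  Σ = sumL R

  Π : ∀ {n} → Subset n → (Fin n → Carrier) → Carrier
  Π = prodIn R

  Σ-map : ∀ {m n} (h : Subset m → Subset n) xs f → Σ (map h xs) f P.≡ Σ xs (λ A → f (h A))
  Σ-map h []       f = P.refl
  Σ-map h (x ∷ xs) f = P.cong (f (h x) +_) (Σ-map h xs f)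

  Σ-++ : ∀ {n} (xs ys : List (Subset n)) f → Σ (xs ++ ys) f ≈ Σ xs f + Σ ys f
  Σ-++ []       ys f = sym (+-identityˡ _)
  Σ-++ (x ∷ xs) ys f = trans (+-congˡ (Σ-++ xs ys f)) (sym (+-assoc _ _ _))

  Σ-cong : ∀ {n} (xs : List (Subset n)) {f g} → (∀ A → f A ≈ g A) → Σ xs f ≈ Σ xs g
  Σ-cong []       eq = refl
  Σ-cong (x ∷ xs) eq = +-cong (eq x) (Σ-cong xs eq)

  Σ-+ : ∀ {n} (xs : List (Subset n)) f g → Σ xs (λ A → f A + g A) ≈ Σ xs f + Σ xs g
  Σ-+ []       f g = sym (+-identityˡ _)
  Σ-+ (x ∷ xs) f g = trans (+-congˡ (Σ-+ xs f g)) (+-interchange _ _ _ _)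

  Σ-distribˡ : ∀ {n} (xs : List (Subset n)) k f → k * Σ xs f ≈ Σ xs (λ A → k * f A)
  Σ-distribˡ []       k f = zeroʳ k
  Σ-distribˡ (x ∷ xs) k f = trans (distribˡ k _ _) (+-congˡ (Σ-distribˡ xs k f))

  Σ-outside : ∀ {n} (G : Subset n) (f : Subset (suc n) → Carrier) →
    Σ (subsetsOf (false ∷ G)) f P.≡ Σ (subsetsOf G) (λ A → f (false ∷ A))
  Σ-outside G f = Σ-map (false ∷_) (subsetsOf G) f

  Σ-inside : ∀ {n} (G : Subset n) (f : Subset (suc n) → Carrier) →
    Σ (subsetsOf (true ∷ G)) f
      ≈ Σ (subsetsOf G) (λ A → f (false ∷ A)) + Σ (subsetsOf G) (λ A → f (true ∷ A))
  Σ-inside G f = trans (Σ-++ (map (false ∷_) (subsetsOf G)) _ f)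
    (+-cong (reflexive (Σ-map _ (subsetsOf G) f)) (reflexive (Σ-map _ (subsetsOf G) f)))

  Σ-cong-⊑ : ∀ {n} (G : Subset n) {f g : Subset n → Carrier} →
    (∀ A → A ⊑ G → f A ≈ g A) → Σ (subsetsOf G) f ≈ Σ (subsetsOf G) g
  Σ-cong-⊑ [] eq = +-cong (eq [] []⊑[]) refl
  Σ-cong-⊑ (false ∷ G) {f} {g} eq = begin
    Σ (subsetsOf (false ∷ G)) f                ≡⟨ Σ-outside G f ⟩
    Σ (subsetsOf G) (λ A → f (false ∷ A))      ≈⟨ Σ-cong-⊑ G (λ A A⊑G → eq _ (outside A⊑G)) ⟩
    Σ (subsetsOf G) (λ A → g (false ∷ A))      ≡⟨ Σ-outside G g ⟨
    Σ (subsetsOf (false ∷ G)) g                ∎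
  Σ-cong-⊑ (true ∷ G) {f} {g} eq = begin
    Σ (subsetsOf (true ∷ G)) f                 ≈⟨ Σ-inside G f ⟩
    Σ (subsetsOf G) (λ A → f (false ∷ A)) + Σ (subsetsOf G) (λ A → f (true ∷ A))
      ≈⟨ +-cong (Σ-cong-⊑ G (λ A A⊑G → eq _ (skipped A⊑G)))
                (Σ-cong-⊑ G (λ A A⊑G → eq _ (taken A⊑G))) ⟩
    Σ (subsetsOf G) (λ A → g (false ∷ A)) + Σ (subsetsOf G) (λ A → g (true ∷ A))
      ≈⟨ Σ-inside G g ⟨
    Σ (subsetsOf (true ∷ G)) g                 ∎

  -- The three ways the first position can be distributed between two
  -- complementary products: in neither, in the right one, in the left one.
  neither : ∀ a b → 1# * (a * b) ≈ (1# * a) * (1# * b)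
  neither a b = trans (*-identityˡ _) (sym (*-cong (*-identityˡ a) (*-identityˡ b)))

  toRight : ∀ x a b → x * (a * b) ≈ (1# * a) * (x * b)
  toRight x a b = trans (*-solve 3 (λ x a b → (x ⊛ (a ⊛ b)) ⊜ (a ⊛ (x ⊛ b))) refl x a b)
                        (*-congʳ (sym (*-identityˡ a)))

  toLeft : ∀ x a b → x * (a * b) ≈ (x * a) * (1# * b)
  toLeft x a b = trans (sym (*-assoc x a b)) (*-congˡ (sym (*-identityˡ b)))

  Π-cong : ∀ {n} (A : Subset n) {f g : Fin n → Carrier} → (∀ e → f e ≈ g e) → Π A f ≈ Π A g
  Π-cong []          eq = refl
  Π-cong (false ∷ A) eq = *-congˡ (Π-cong A (λ e → eq (Fin.suc e)))
  Π-cong (true ∷ A)  eq = *-cong (eq Fin.zero) (Π-cong A (λ e → eq (Fin.suc e)))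

  Π-* : ∀ {n} (A : Subset n) (f g : Fin n → Carrier) → Π A f * Π A g ≈ Π A (λ e → f e * g e)
  Π-* []          f g = *-identityˡ 1#
  Π-* (false ∷ A) f g = trans (sym (neither _ _)) (*-congˡ (Π-* A _ _))
  Π-* (true ∷ A)  f g = trans (*-solve 4 (λ a b c d → ((a ⊛ b) ⊛ (c ⊛ d)) ⊜ ((a ⊛ c) ⊛ (b ⊛ d))) refl _ _ _ _)
                             (*-congˡ (Π-* A _ _))

  Π-ones : ∀ {n} (A : Subset n) {f : Fin n → Carrier} → (∀ e → f e ≈ 1#) → Π A f ≈ 1#
  Π-ones []          eq = refl
  Π-ones (false ∷ A) eq = trans (*-identityˡ _) (Π-ones A (λ e → eq (Fin.suc e)))
  Π-ones (true ∷ A)  eq = trans (*-cong (eq Fin.zero) (Π-ones A (λ e → eq (Fin.suc e)))) (*-identityˡ 1#)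

  Π-split : ∀ {n} {C G : Subset n} → C ⊑ G → (q : Fin n → Carrier) → Π G q ≈ Π C q * Π (G ─ C) q
  Π-split []⊑[]       q = sym (*-identityˡ 1#)
  Π-split (outside s) q = trans (*-congˡ (Π-split s _)) (neither _ _)
  Π-split (skipped s) q = trans (*-congˡ (Π-split s _)) (toRight _ _ _)
  Π-split (taken s)   q = trans (*-congˡ (Π-split s _)) (toLeft _ _ _)

  Π-split-between : ∀ {n} {A C G : Subset n} → A ⊑ C → C ⊑ G → (q : Fin n → Carrier) →
    Π (G ─ A) q ≈ Π (C ─ A) q * Π (G ─ C) q
  Π-split-between []⊑[]       []⊑[]       q = sym (*-identityˡ 1#)
  Π-split-between (outside s) (outside t) q = trans (*-congˡ (Π-split-between s t _)) (neither _ _)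
  Π-split-between (outside s) (skipped t) q = trans (*-congˡ (Π-split-between s t _)) (toRight _ _ _)
  Π-split-between (skipped s) (taken t)   q = trans (*-congˡ (Π-split-between s t _)) (toLeft _ _ _)
  Π-split-between (taken s)   (taken t)   q = trans (*-congˡ (Π-split-between s t _)) (neither _ _)

  binomial : ∀ {n} (C : Subset n) (f g : Fin n → Carrier) →
    Σ (subsetsOf C) (λ A → Π A f * Π (C ─ A) g) ≈ Π C (λ e → f e + g e)
  binomial [] f g = trans (+-identityʳ _) (*-identityˡ 1#)
  binomial {suc n} (false ∷ C) f g = begin
    Σ (subsetsOf (false ∷ C)) (λ A → Π A f * Π ((false ∷ C) ─ A) g)
      ≡⟨ Σ-outside C _ ⟩
    Σ (subsetsOf C) (λ A → (1# * Π A f′) * (1# * Π (C ─ A) g′))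
      ≈⟨ Σ-cong (subsetsOf C) (λ A → sym (neither _ _)) ⟩
    Σ (subsetsOf C) (λ A → 1# * (Π A f′ * Π (C ─ A) g′))
      ≈⟨ Σ-distribˡ (subsetsOf C) 1# _ ⟨
    1# * Σ (subsetsOf C) (λ A → Π A f′ * Π (C ─ A) g′)
      ≈⟨ *-congˡ (binomial C f′ g′) ⟩
    Π (false ∷ C) (λ e → f e + g e)
      ∎
    where
    f′ g′ : Fin n → Carrier
    f′ e = f (Fin.suc e)
    g′ e = g (Fin.suc e)
  binomial {suc n} (true ∷ C) f g = begin
    Σ (subsetsOf (true ∷ C)) (λ A → Π A f * Π ((true ∷ C) ─ A) g)
      ≈⟨ Σ-inside C _ ⟩
    Σ (subsetsOf C) (λ A → (1# * Π A f′) * (g Fin.zero * Π (C ─ A) g′))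
      + Σ (subsetsOf C) (λ A → (f Fin.zero * Π A f′) * (1# * Π (C ─ A) g′))
      ≈⟨ +-cong (Σ-cong (subsetsOf C) (λ A → sym (toRight _ _ _)))
                (Σ-cong (subsetsOf C) (λ A → sym (toLeft _ _ _))) ⟩
    Σ (subsetsOf C) (λ A → g Fin.zero * (Π A f′ * Π (C ─ A) g′))
      + Σ (subsetsOf C) (λ A → f Fin.zero * (Π A f′ * Π (C ─ A) g′))
      ≈⟨ +-cong (Σ-distribˡ (subsetsOf C) _ _) (Σ-distribˡ (subsetsOf C) _ _) ⟨
    g Fin.zero * S + f Fin.zero * S
      ≈⟨ distribʳ S _ _ ⟨
    (g Fin.zero + f Fin.zero) * S
      ≈⟨ *-cong (+-comm _ _) (binomial C f′ g′) ⟩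
    Π (true ∷ C) (λ e → f e + g e)
      ∎
    where
    f′ g′ : Fin n → Carrier
    f′ e = f (Fin.suc e)
    g′ e = g (Fin.suc e)
    S : Carrier
    S = Σ (subsetsOf C) (λ A → Π A f′ * Π (C ─ A) g′)

  -- The two shapes of a double sum over nested subsets of G, for a summand
  -- H A B C that is meaningful when C = A ⊎ B:
  -- disjointSum sums over A ⊆ G and B ⊆ G ∖ A (with C = B ∪ A),
  -- nestedSum sums over C ⊆ G and A ⊆ C (with B = C ∖ A).
  Summand : ℕ → Set c
  Summand n = Subset n → Subset n → Subset n → Carrier

  disjointSum : ∀ {n} → Subset n → Summand n → Carrier
  disjointSum G H = Σ (subsetsOf G) (λ A → Σ (subsetsOf (G ─ A)) (λ B → H A B (B ∪ A)))

  nestedSum : ∀ {n} → Subset n → Summand n → Carrier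
  nestedSum G H = Σ (subsetsOf G) (λ C → Σ (subsetsOf C) (λ A → H A (C ─ A) C))

  restrict : ∀ {n} → Summand (suc n) → (a b c : Bool) → Summand n
  restrict H a b c A B C = H (a ∷ A) (b ∷ B) (c ∷ C)

  disjointSum-outside : ∀ {n} (G : Subset n) (H : Summand (suc n)) →
    disjointSum (false ∷ G) H ≈ disjointSum G (restrict H false false false)
  disjointSum-outside G H = begin
    disjointSum (false ∷ G) H
      ≡⟨ Σ-outside G _ ⟩
    Σ (subsetsOf G) (λ A → Σ (subsetsOf (false ∷ (G ─ A))) (λ B → H (false ∷ A) B (B ∪ (false ∷ A))))
      ≈⟨ Σ-cong (subsetsOf G) (λ A → reflexive (Σ-outside (G ─ A) _)) ⟩
    disjointSum G (restrict H false false false)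
      ∎

  disjointSum-inside : ∀ {n} (G : Subset n) (H : Summand (suc n)) →
    disjointSum (true ∷ G) H
      ≈ disjointSum G (restrict H false false false)
        + (disjointSum G (restrict H false true true) + disjointSum G (restrict H true false true))
  disjointSum-inside G H = begin
    disjointSum (true ∷ G) H
      ≈⟨ Σ-inside G _ ⟩
    Σ (subsetsOf G) (λ A → Σ (subsetsOf (true ∷ (G ─ A))) (λ B → H (false ∷ A) B (B ∪ (false ∷ A))))
      + Σ (subsetsOf G) (λ A → Σ (subsetsOf (false ∷ (G ─ A))) (λ B → H (true ∷ A) B (B ∪ (true ∷ A))))
      ≈⟨ +-cong (trans (Σ-cong (subsetsOf G) (λ A → Σ-inside (G ─ A) _)) (Σ-+ (subsetsOf G) _ _))
                (Σ-cong (subsetsOf G) (λ A → reflexive (Σ-outside (G ─ A) _))) ⟩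
    (disjointSum G (restrict H false false false) + disjointSum G (restrict H false true true))
      + disjointSum G (restrict H true false true)
      ≈⟨ +-assoc _ _ _ ⟩
    disjointSum G (restrict H false false false)
      + (disjointSum G (restrict H false true true) + disjointSum G (restrict H true false true))
      ∎

  nestedSum-outside : ∀ {n} (G : Subset n) (H : Summand (suc n)) →
    nestedSum (false ∷ G) H ≈ nestedSum G (restrict H false false false)
  nestedSum-outside G H = begin
    nestedSum (false ∷ G) H
      ≡⟨ Σ-outside G _ ⟩
    Σ (subsetsOf G) (λ C → Σ (subsetsOf (false ∷ C)) (λ A → H A ((false ∷ C) ─ A) (false ∷ C)))
      ≈⟨ Σ-cong (subsetsOf G) (λ C → reflexive (Σ-outside C _)) ⟩
    nestedSum G (restrict H false false false)
      ∎

  nestedSum-inside : ∀ {n} (G : Subset n) (H : Summand (suc n)) →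
    nestedSum (true ∷ G) H
      ≈ nestedSum G (restrict H false false false)
        + (nestedSum G (restrict H false true true) + nestedSum G (restrict H true false true))
  nestedSum-inside G H = begin
    nestedSum (true ∷ G) H
      ≈⟨ Σ-inside G _ ⟩
    Σ (subsetsOf G) (λ C → Σ (subsetsOf (false ∷ C)) (λ A → H A ((false ∷ C) ─ A) (false ∷ C)))
      + Σ (subsetsOf G) (λ C → Σ (subsetsOf (true ∷ C)) (λ A → H A ((true ∷ C) ─ A) (true ∷ C)))
      ≈⟨ +-cong (Σ-cong (subsetsOf G) (λ C → reflexive (Σ-outside C _)))
                (trans (Σ-cong (subsetsOf G) (λ C → Σ-inside C _)) (Σ-+ (subsetsOf G) _ _)) ⟩
    nestedSum G (restrict H false false false)
      + (nestedSum G (restrict H false true true) + nestedSum G (restrict H true false true))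
      ∎

  -- Reindexing (A, B) ↦ (A, A ∪ B): pairs of disjoint subsets of G
  -- correspond to pairs A ⊆ C ⊆ G.
  disjoint≈nested : ∀ {n} (G : Subset n) (H : Summand n) → disjointSum G H ≈ nestedSum G H
  disjoint≈nested []          H = refl
  disjoint≈nested (false ∷ G) H = begin
    disjointSum (false ∷ G) H                     ≈⟨ disjointSum-outside G H ⟩
    disjointSum G (restrict H false false false)  ≈⟨ disjoint≈nested G (restrict H false false false) ⟩
    nestedSum G (restrict H false false false)    ≈⟨ nestedSum-outside G H ⟨
    nestedSum (false ∷ G) H                       ∎
  disjoint≈nested (true ∷ G) H = begin
    disjointSum (true ∷ G) H
      ≈⟨ disjointSum-inside G H ⟩
    disjointSum G (restrict H false false false)
      + (disjointSum G (restrict H false true true) + disjointSum G (restrict H true false true))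
      ≈⟨ +-cong (disjoint≈nested G (restrict H false false false))
                (+-cong (disjoint≈nested G (restrict H false true true))
                        (disjoint≈nested G (restrict H true false true))) ⟩
    nestedSum G (restrict H false false false)
      + (nestedSum G (restrict H false true true) + nestedSum G (restrict H true false true))
      ≈⟨ nestedSum-inside G H ⟨
    nestedSum (true ∷ G) H
      ∎

  module IntegerPowers (s t : Carrier) (st≈1 : s * t ≈ 1#) where

    s^ : ℤ → Carrier
    s^ = zpow R s t

    s^-suc : ∀ a → s^ (sucℤ a) ≈ s * s^ a
    s^-suc (pos m)          = refl
    s^-suc -[1+ zero ]      = sym (trans (*-congˡ (*-identityʳ t)) st≈1)
    s^-suc -[1+ suc k ]     = sym (trans (sym (*-assoc s t _)) (trans (*-congʳ st≈1) (*-identityˡ _)))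

    s^-pred : ∀ a → s^ (pred a) ≈ t * s^ a
    s^-pred (pos zero)      = refl
    s^-pred (pos (suc m))   =
      sym (trans (sym (*-assoc t s _)) (trans (*-congʳ (trans (*-comm t s) st≈1)) (*-identityˡ _)))
    s^-pred -[1+ k ]        = refl

    s^-+ : ∀ a b → s^ (a +ℤ b) ≈ s^ a * s^ b
    s^-+ (pos zero) b       = trans (reflexive (P.cong s^ (ℤ.+-identityˡ b))) (sym (*-identityˡ _))
    s^-+ (pos (suc m)) b    = trans (reflexive (P.cong s^ (ℤ.suc-+ m b)))
      (trans (s^-suc (pos m +ℤ b)) (trans (*-congˡ (s^-+ (pos m) b)) (sym (*-assoc _ _ _))))
    s^-+ -[1+ zero ] b      = trans (s^-pred b) (*-congʳ (sym (*-identityʳ t)))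
    s^-+ -[1+ suc k ] b     = trans (reflexive (P.cong s^ (ℤ.pred-+ -[1+ k ] b)))
      (trans (s^-pred (-[1+ k ] +ℤ b)) (trans (*-congˡ (s^-+ -[1+ k ] b)) (sym (*-assoc _ _ _))))

    s^-telescope : ∀ a c → s^ (-ℤ a) * s^ (-ℤ (c -ℤ a)) ≈ s^ (-ℤ c)
    s^-telescope a c = trans (sym (s^-+ (-ℤ a) _)) (reflexive (P.cong s^ (neg-telescope a c)))

  -- The one-element case of the binomial expansion in the theorem:
  -- p (-v) + (1 - p) v = v (1 - 2p).
  weight-identity : ∀ p v → p * (- v) + (1# - p) * v ≈ v * (1# - (1# + 1#) * p)
  weight-identity p v = begin
    p * (- v) + (1# - p) * v
      ≈⟨ +-cong (trans (sym (-‿distribʳ-* p v)) (-‿cong (*-comm p v)))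
                (trans (distribʳ v 1# (- p))
                       (+-cong (*-identityˡ v) (trans (sym (-‿distribˡ-* p v)) (-‿cong (*-comm p v))))) ⟩
    - (v * p) + (v + - (v * p))
      ≈⟨ +-solve 2 (λ x y → (x ⊕ (y ⊕ x)) ⊜₊ (y ⊕ (x ⊕ x))) refl (- (v * p)) v ⟩
    v + (- (v * p) + - (v * p))
      ≈⟨ +-congˡ (⁻¹-∙-comm (v * p) (v * p)) ⟩
    v + - (v * p + v * p)
      ≈⟨ +-congˡ (-‿cong (trans (sym (distribˡ v p p))
                         (*-congˡ (sym (trans (distribʳ p 1# 1#) (+-cong (*-identityˡ p) (*-identityˡ p))))))) ⟩
    v + - (v * ((1# + 1#) * p))
      ≈⟨ +-cong (sym (*-identityʳ v)) (-‿distribʳ-* v _) ⟩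
    v * 1# + v * (- ((1# + 1#) * p))
      ≈⟨ distribˡ v 1# _ ⟨
    v * (1# - (1# + 1#) * p)
      ∎
    where
    open CommutativeMonoidSolver +-commutativeMonoid using (_⊕_) renaming (solve to +-solve; _⊜_ to _⊜₊_)
    open AbelianGroupProperties +-abelianGroup using (⁻¹-∙-comm)

  module _ {n : ℕ} (M : RSM n Carrier) (s sinv : Carrier) (s*sinv≈1 : s * sinv ≈ 1#) where
    open IntegerPowers s sinv s*sinv≈1
    private
      E : Subset n
      E = ground M
      r : Subset n → ℤ
      r = rank M
      m : Subset n → Carrier
      m = mult M

    expectation-formula : (p v : Fin n → Carrier) →
      expect R E p (λ A → s^ (-ℤ r A) * Π A (λ e → - v e) * Z R (contract M A) s sinv v)
      ≈ Σ (subsetsOf E) (λ C →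
          m C * s^ (-ℤ r C) * Π C (λ e → v e * (1# - (1# + 1#) * p e)) * Π (E ─ C) (λ e → 1# - p e))
    expectation-formula p v = begin
      Σ (subsetsOf E) (λ A → weight A * (s^ (-ℤ r A) * Π A -v * Σ (subsetsOf (E ─ A)) (contracted A)))
        ≈⟨ Σ-cong (subsetsOf E) (λ A → trans
             (*-solve 4 (λ k z w y → (k ⊛ ((z ⊛ w) ⊛ y)) ⊜ ((k ⊛ (z ⊛ w)) ⊛ y)) refl _ _ _ _)
             (Σ-distribˡ (subsetsOf (E ─ A)) _ (contracted A))) ⟩
      disjointSum E H
        ≈⟨ disjoint≈nested E H ⟩
      nestedSum E H
        ≈⟨ Σ-cong-⊑ E nested-inner ⟩
      Σ (subsetsOf E) (λ C → m C * s^ (-ℤ r C) * Π C target * Π (E ─ C) p̄)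
        ∎
      where
      p̄ -v target : Fin n → Carrier
      p̄ e = 1# - p e
      -v e = - v e
      target e = v e * (1# - (1# + 1#) * p e)

      -- Probability that E_p equals A.
      weight : Subset n → Carrier
      weight A = Π A p * Π (E ─ A) p̄

      contracted : Subset n → Subset n → Carrier
      contracted A B = m (B ∪ A) * s^ (-ℤ (r (B ∪ A) -ℤ r A)) * Π B v

      H : Summand n
      H A B C = (weight A * (s^ (-ℤ r A) * Π A -v)) * (m C * s^ (-ℤ (r C -ℤ r A)) * Π B v)

      -- For A ⊆ C ⊆ E the summand is a C-dependent constant times a binomial term.
      summand-factorises : ∀ {A C} → A ⊑ C → C ⊑ E →
        H A (C ─ A) C ≈ (m C * s^ (-ℤ r C) * Π (E ─ C) p̄)
                          * (Π A (λ e → p e * -v e) * Π (C ─ A) (λ e → p̄ e * v e))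
      summand-factorises {A} {C} A⊑C C⊑E = begin
        H A (C ─ A) C
          ≈⟨ *-congʳ (*-congʳ (*-congˡ (Π-split-between A⊑C C⊑E p̄))) ⟩
        (Π A p * (Π (C ─ A) p̄ * Π (E ─ C) p̄) * (s^ (-ℤ r A) * Π A -v))
          * (m C * s^ (-ℤ (r C -ℤ r A)) * Π (C ─ A) v)
          ≈⟨ *-solve 8 (λ a y w za va mc zca vb →
                 (((a ⊛ (y ⊛ w)) ⊛ (za ⊛ va)) ⊛ ((mc ⊛ zca) ⊛ vb))
               ⊜ (((mc ⊛ (za ⊛ zca)) ⊛ w) ⊛ ((a ⊛ va) ⊛ (y ⊛ vb)))) refl _ _ _ _ _ _ _ _ ⟩
        ((m C * (s^ (-ℤ r A) * s^ (-ℤ (r C -ℤ r A)))) * Π (E ─ C) p̄)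
          * ((Π A p * Π A -v) * (Π (C ─ A) p̄ * Π (C ─ A) v))
          ≈⟨ *-cong (*-congʳ (*-congˡ (s^-telescope (r A) (r C))))
                    (*-cong (Π-* A p -v) (Π-* (C ─ A) p̄ v)) ⟩
        (m C * s^ (-ℤ r C) * Π (E ─ C) p̄) * (Π A (λ e → p e * -v e) * Π (C ─ A) (λ e → p̄ e * v e))
          ∎

      nested-inner : ∀ C → C ⊑ E →
        Σ (subsetsOf C) (λ A → H A (C ─ A) C) ≈ m C * s^ (-ℤ r C) * Π C target * Π (E ─ C) p̄
      nested-inner C C⊑E = begin
        Σ (subsetsOf C) (λ A → H A (C ─ A) C)
          ≈⟨ Σ-cong-⊑ C (λ A A⊑C → summand-factorises A⊑C C⊑E) ⟩
        Σ (subsetsOf C) (λ A → K * (Π A (λ e → p e * -v e) * Π (C ─ A) (λ e → p̄ e * v e)))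
          ≈⟨ Σ-distribˡ (subsetsOf C) K _ ⟨
        K * Σ (subsetsOf C) (λ A → Π A (λ e → p e * -v e) * Π (C ─ A) (λ e → p̄ e * v e))
          ≈⟨ *-congˡ (trans (binomial C _ _) (Π-cong C (λ e → weight-identity (p e) (v e)))) ⟩
        K * Π C target
          ≈⟨ *-solve 4 (λ a b c d → (((a ⊛ b) ⊛ c) ⊛ d) ⊜ (((a ⊛ b) ⊛ d) ⊛ c)) refl _ _ _ _ ⟩
        m C * s^ (-ℤ r C) * Π C target * Π (E ─ C) p̄
          ∎
        where
        K : Carrier
        K = m C * s^ (-ℤ r C) * Π (E ─ C) p̄

    -- Clearing the denominators 1 - u (with inverses w) reduces the rational
    -- identity to the expectation formula at p = u.
    rational-identity : (u w v : Fin n → Carrier) → (∀ e → (1# - u e) * w e ≈ 1#) →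
      Π E (λ e → 1# - u e) * Z R M s sinv (λ e → v e * (1# - (1# + 1#) * u e) * w e)
      ≈ Σ (subsetsOf E) (λ A →
          s^ (-ℤ r A) * Π A (λ e → - v e) * Z R (contract M A) s sinv v
          * Π A u * Π (E ─ A) (λ e → 1# - u e))
    rational-identity u w v ū*w≈1 = begin
      Π E ū * Σ (subsetsOf E) (λ C → m C * s^ (-ℤ r C) * Π C (λ e → target e * w e))
        ≈⟨ Σ-distribˡ (subsetsOf E) _ _ ⟩
      Σ (subsetsOf E) (λ C → Π E ū * (m C * s^ (-ℤ r C) * Π C (λ e → target e * w e)))
        ≈⟨ Σ-cong-⊑ E denominators-cancel ⟩
      Σ (subsetsOf E) (λ C → m C * s^ (-ℤ r C) * Π C target * Π (E ─ C) ū)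
        ≈⟨ expectation-formula u v ⟨
      Σ (subsetsOf E) (λ A → Π A u * Π (E ─ A) ū * (s^ (-ℤ r A) * Π A -v * Z R (contract M A) s sinv v))
        ≈⟨ Σ-cong (subsetsOf E) (λ A →
             *-solve 5 (λ a b z va zc → ((a ⊛ b) ⊛ ((z ⊛ va) ⊛ zc)) ⊜ ((((z ⊛ va) ⊛ zc) ⊛ a) ⊛ b))
                     refl _ _ _ _ _) ⟩
      Σ (subsetsOf E) (λ A → s^ (-ℤ r A) * Π A -v * Z R (contract M A) s sinv v * Π A u * Π (E ─ A) ū)
        ∎
      where
      ū -v target : Fin n → Carrier
      ū e = 1# - u e
      -v e = - v e
      target e = v e * (1# - (1# + 1#) * u e)

      -- ∏_E(1-u) = ∏_C(1-u) ∏_{E∖C}(1-u), and ∏_C(1-u) cancels against ∏_C w.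
      denominators-cancel : ∀ C → C ⊑ E →
        Π E ū * (m C * s^ (-ℤ r C) * Π C (λ e → target e * w e))
        ≈ m C * s^ (-ℤ r C) * Π C target * Π (E ─ C) ū
      denominators-cancel C C⊑E = begin
        Π E ū * (m C * s^ (-ℤ r C) * Π C (λ e → target e * w e))
          ≈⟨ *-cong (Π-split C⊑E ū) (*-congˡ (sym (Π-* C target w))) ⟩
        (Π C ū * Π (E ─ C) ū) * (m C * s^ (-ℤ r C) * (Π C target * Π C w))
          ≈⟨ *-solve 6 (λ a b mc z t x → ((a ⊛ b) ⊛ ((mc ⊛ z) ⊛ (t ⊛ x)))
                                        ⊜ ((((mc ⊛ z) ⊛ t) ⊛ b) ⊛ (a ⊛ x))) refl _ _ _ _ _ _ ⟩
        (m C * s^ (-ℤ r C) * Π C target * Π (E ─ C) ū) * (Π C ū * Π C w)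
          ≈⟨ *-congˡ (trans (Π-* C ū w) (Π-ones C ū*w≈1)) ⟩
        (m C * s^ (-ℤ r C) * Π C target * Π (E ─ C) ū) * 1#
          ≈⟨ *-identityʳ _ ⟩
        m C * s^ (-ℤ r C) * Π C target * Π (E ─ C) ū
          ∎

theorem4p12 : ∀ {c ℓ} (R : CommutativeRing c ℓ) → let open CommutativeRing R in
    ∀ (n : ℕ) (M : RSM n Carrier) (s sinv : Carrier) → s * sinv ≈ 1# →
    ((u w v : Fin n → Carrier) → (∀ e → (1# - u e) * w e ≈ 1#) →
      prodIn R (ground M) (λ e → 1# - u e)
        * Z R M s sinv (λ e → v e * (1# - (1# + 1#) * u e) * w e)
      ≈ sumL R (subsetsOf (ground M)) (λ A →
          zpow R s sinv (-ℤ rank M A) * prodIn R A (λ e → - v e)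
          * Z R (contract M A) s sinv v
          * prodIn R A u * prodIn R (ground M ─ A) (λ e → 1# - u e)))
    ×
    ((p v : Fin n → Carrier) →
      expect R (ground M) p (λ A →
          zpow R s sinv (-ℤ rank M A) * prodIn R A (λ e → - v e)
          * Z R (contract M A) s sinv v)
      ≈ sumL R (subsetsOf (ground M)) (λ A →
          mult M A * zpow R s sinv (-ℤ rank M A)
          * prodIn R A (λ e → v e * (1# - (1# + 1#) * p e))
          * prodIn R (ground M ─ A) (λ e → 1# - p e)))
theorem4p12 R n M s sinv s*sinv≈1 =
  rational-identity R M s sinv s*sinv≈1 , expectation-formula R M s sinv s*sinv≈1
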